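{- Let $\mathcal{I}$ be an inference system over a set $\mathcal{S}$ of propositions, with a fixed well-founded strict order $\prec$ on $\mathcal{S}$, such that: $\mathcal{I}$ is finite in conclusions and has a complement $\mathcal{J}$; $\mathcal{I}$ is included in and equivalent to a saturated system $\mathcal{I}'$; and the system $\mathcal{A}$ consisting of the introduction rules of $\mathcal{I}'$ is finite in conclusions and has a complement $\mathcal{B}$. Then, for every proposition $A$, if the sequent $\not\vdash A$ has a proof in the system $\mathcal{A}_{\mathcal{B}}$, it has a (possibly infinite) proof in the system $\mathcal{I}_{\mathcal{J}}$.
   Context: An inference rule over $\mathcal{S}$ is a partial function $f:\mathcal{S}^n\rightharpoonup\mathcal{S}$ ($n\ge 0$ its number of premises); $B$ is derivable from $\langle A_1,\dots,A_n\rangle$ with $f$ if $f(A_1,\dots,A_n)$ is defined and equals $B$. An inference system is a set of rules; it is finite in conclusions if each proposition is derivable with a rule of the system from only finitely many sequences. A (possibly infinite) proof is a (possibly infinite) tree labeled with propositions (or sequents) where every node labeled $B$ with children labeled $A_1,\dots,A_n$ has $B$ derivable from $\langle A_1,\dots,A_n\rangle$ by a rule of the system. Two systems are equivalent if the same propositions have finite proofs in them. Complement: for $\mathcal{I}$ finite in conclusions, $\mathcal{J}$ is a complement of $\mathcal{I}$ if $\mathcal{J}$ is finite in conclusions and for every $B$, if $\langle A^1_1,\dots,A^1_{n_1}\rangle,\dots,\langle A^p_1,\dots,A^p_{n_p}\rangle$ are all sequences from which $B$ is derivable with a rule of $\mathcal{I}$, then the sequences from which $B$ is derivable with a rule of $\mathcal{J}$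 are exactly the $\langle A^1_{j_1},\dots,A^p_{j_p}\rangle$, $1\le j_i\le n_i$. The complementation $\mathcal{I}_{\mathcal{J}}$ is the system on sequents $\vdash A$, $\not\vdash A$ with, for each $f\in\mathcal{I}$, the rule $\vdash A_1,\dots,\vdash A_n \mapsto\ \vdash f(A_1,\dots,A_n)$, and for each $f\in\mathcal{J}$, the rule $\not\vdash A_1,\dots,\not\vdash A_n\mapsto\ \not\vdash f(A_1,\dots,A_n)$; $\mathcal{A}_{\mathcal{B}}$ is defined in the same way. Introduction rules: a rule $r$ is an introduction rule if whenever $B$ is derivable from $\langle A_1,\dots,A_n\rangle$ with $r$, $A_i\prec B$ for all $i$. For each non-introduction rule, its premises are classified as major or non-major, the major premises being its $m$ leftmost premises for some $m\ge1$. Derivable rule: if $g$ has $n$ premises and each $f_i$ ($1\le i\le n$) is either a rule with $m_i$ premises or the identity (with $m_i=1$), the composition of $g$ with $f_1,\dots,f_n$ is the rule $h(x^1_1,\dots,x^1_{m_1},\dots,x^n_1,\dots,x^n_{m_n})=g(f_1(x^1_1,\dots,x^1_{m_1}),\dots,f_n(x^n_1,\dots,x^n_{m_n}))$, defined exactly when all inner applications and the outer one are defined. Simplification: if a rule $f$ with domain $D$ has positions $i\neq j$ with $x_i=x_j$ for all tuples in $D$, it may be replaced by the rule $f'$ obtained by dropping the $j$-th argument (and using $x_i$ in its place); the simplification of a rule is the result of performing such replacements until none applies. Saturated system: a system is saturated if whenever it contains a non-introduction rule $g$ with $n$ premises whose $m$ leftmost premises are major, and $m$ introduction rules $f_1,\dots,f_m$,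 it also contains the simplification of the composition of $g$ with $f_1,\dots,f_m$ and $n-m$ times the identity function. -}

module Defs where

open import Level using (Level; _⊔_) renaming (suc to lsuc; zero to lzero)
open import Data.Nat using (ℕ; zero; suc; _+_; _∸_; _≤_)
open import Data.Nat.Properties using (m+[n∸m]≡n)
open import Data.Fin using (Fin)
open import Data.Vec using (Vec; []; _∷_; lookup; removeAt; cast; take; drop; _++_; map)
open import Data.Vec.Membership.Propositional renaming (_∈_ to _∈ᵥ_)
open import Data.List using (List; []; _∷_)
open import Data.List.Membership.Propositional using (_∈_)
open import Data.List.Relation.Unary.Unique.Propositional using (Unique)
open import Data.Product using (Σ; _×_; _,_; proj₁; proj₂)
open import Data.Sum using (_⊎_; inj₁; inj₂)
open import Data.Unit using (⊤)
open import Relation.Binary.PropositionalEquality using (_≡_; _≢_)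
open import Relation.Nullary using (¬_)
open import Function.Bundles using (_⇔_)

-- A rule with n premises over propositions S: the graph of a partial
-- function S^n ⇀ S, given as a relation  (premises , conclusion).
Rule : Set → ℕ → Set₁
Rule S n = Vec S n → S → Set

FunctionalRule : {S : Set} {n : ℕ} → Rule S n → Set
FunctionalRule {S} {n} f = ∀ (xs : Vec S n) (B B' : S) → f xs B → f xs B' → B ≡ B'

_≐_ : {S : Set} {n : ℕ} → Rule S n → Rule S n → Set
_≐_ {S} {n} f g = ∀ (xs : Vec S n) (B : S) → (f xs B → g xs B) × (g xs B → f xs B)

record System (S : Set) : Set₁ where
  field
    Idx   : Set
    arity : Idx → ℕ
    rule  : (i : Idx) → Rule S (arity i)
open System public

Functional : {S : Set} → System S → Set
Functional 𝓘 = ∀ i → FunctionalRule (rule 𝓘 i)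

Seq : Set → Set
Seq S = Σ ℕ (Vec S)

Derivable : {S : Set} → System S → S → Seq S → Set
Derivable {S} 𝓘 B s =
  Σ (Idx 𝓘) λ i → Σ (Vec S (arity 𝓘 i)) λ ys → (s ≡ (arity 𝓘 i , ys)) × rule 𝓘 i ys B

Enumerates : {S : Set} → System S → S → List (Seq S) → Set
Enumerates 𝓘 B L = Unique L × (∀ s → (s ∈ L) ⇔ Derivable 𝓘 B s)

FiniteInConclusions : {S : Set} → System S → Set
FiniteInConclusions {S} 𝓘 = ∀ (B : S) → Σ (List (Seq S)) λ L → Enumerates 𝓘 B L

-- Choice L s : s = ⟨A¹_{j₁},…,Aᵖ_{jₚ}⟩ where L = ⟨A¹…⟩,…,⟨Aᵖ…⟩.
data Choice {S : Set} : List (Seq S) → Seq S → Set where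
  []  : Choice [] (0 , [])
  _∷_ : ∀ {n k} {xs : Vec S n} {L : List (Seq S)} {y : S} {ys : Vec S k} →
        y ∈ᵥ xs → Choice L (k , ys) → Choice ((n , xs) ∷ L) (suc k , y ∷ ys)

-- 𝓙 is a complement of 𝓘 (𝓘 finite in conclusions is assumed separately).
IsComplement : {S : Set} → System S → System S → Set
IsComplement {S} 𝓘 𝓙 =
  FiniteInConclusions 𝓙 ×
  (∀ (B : S) → Σ (List (Seq S)) λ L →
     Enumerates 𝓘 B L × (∀ s → Derivable 𝓙 B s ⇔ Choice L s))

data Proof {S : Set} (𝓘 : System S) : S → Set where
  node : ∀ {B} (i : Idx 𝓘) (xs : Vec S (arity 𝓘 i)) → rule 𝓘 i xs B →
         (∀ (t : Fin (arity 𝓘 i)) → Proof 𝓘 (lookup xs t)) → Proof 𝓘 B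

-- Since coinduction
-- (--guardedness) is unavailable, B has a possibly infinite proof iff B lies in
-- a set P of propositions every element of which is the conclusion of a rule
-- instance whose premises are all in P (greatest fixed point of the
-- one-step derivation operator; the tree is unfolded from P).
InfProof : {S : Set} → System S → S → Set₁
InfProof {S} 𝓘 B = Σ (S → Set) λ P → P B ×
  (∀ C → P C → Σ (Idx 𝓘) λ i → Σ (Vec S (arity 𝓘 i)) λ xs →
     rule 𝓘 i xs C × (∀ (t : Fin (arity 𝓘 i)) → P (lookup xs t)))

_⊆ₛ_ : {S : Set} → System S → System S → Set
_⊆ₛ_ 𝓘 𝓘' = ∀ (i : Idx 𝓘) → Σ (Idx 𝓘') λ i' →
  Σ (arity 𝓘 i ≡ arity 𝓘' i') λ e →
    ∀ xs B → (rule 𝓘 i xs B → rule 𝓘' i' (cast e xs) B) × (rule 𝓘' i' (cast e xs) B → rule 𝓘 i xs B)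

Equivalent : {S : Set} → System S → System S → Set
Equivalent {S} 𝓘 𝓘' = ∀ (A : S) → Proof 𝓘 A ⇔ Proof 𝓘' A

module _ {S : Set} (_≺_ : S → S → Set) where

  IsIntro : {n : ℕ} → Rule S n → Set
  IsIntro {n} f = ∀ (xs : Vec S n) (B : S) → f xs B → ∀ (t : Fin n) → lookup xs t ≺ B

  MajorClassification : System S → Set
  MajorClassification 𝓘 = ∀ (i : Idx 𝓘) → ¬ IsIntro (rule 𝓘 i) →
    Σ ℕ λ m → (1 ≤ m) × (m ≤ arity 𝓘 i)

  IntroRules : System S → System S
  IntroRules 𝓘 = record
    { Idx   = Σ (Idx 𝓘) λ i → IsIntro (rule 𝓘 i)
    ; arity = λ p → arity 𝓘 (proj₁ p)
    ; rule  = λ p → rule 𝓘 (proj₁ p) }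

sumAr : {S : Set} {m : ℕ} → Vec (Σ ℕ (Rule S)) m → ℕ
sumAr []             = 0
sumAr ((a , _) ∷ fs) = a + sumAr fs

Apps : {S : Set} {m : ℕ} (fs : Vec (Σ ℕ (Rule S)) m) → Vec S (sumAr fs) → Vec S m → Set
Apps []             _  []       = ⊤
Apps ((a , f) ∷ fs) zs (c ∷ cs) = f (take a zs) c × Apps fs (drop a zs) cs

-- Composition of g (n premises) with f₁,…,fₘ in its first m positions and
-- n-m times the identity.
compose : {S : Set} {n m : ℕ} → Rule S n → m ≤ n →
          (fs : Vec (Σ ℕ (Rule S)) m) → Rule S (sumAr fs + (n ∸ m))
compose {S} {n} {m} g m≤n fs zs B =
  Σ (Vec S m) λ cs → Apps fs (take (sumAr fs) zs) cs ×
    g (cast (m+[n∸m]≡n m≤n) (cs ++ drop (sumAr fs) zs)) B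

Coincide : {S : Set} {n : ℕ} → Rule S n → Fin n → Fin n → Set
Coincide {S} {n} f i j = ∀ (xs : Vec S n) (B : S) → f xs B → lookup xs i ≡ lookup xs j

dropArg : {S : Set} {n : ℕ} → Fin (suc n) → Rule S (suc n) → Rule S n
dropArg {S} {n} j f ys B = Σ (Vec S (suc n)) λ xs → (removeAt xs j ≡ ys) × f xs B

Simple : {S : Set} {n : ℕ} → Rule S n → Set
Simple {S} {n} f = ∀ (i j : Fin n) → i ≢ j → ¬ Coincide f i j

data SimplifiesTo {S : Set} : {n p : ℕ} → Rule S n → Rule S p → Set₁ where
  stop : ∀ {n} {f h : Rule S n} → Simple f → f ≐ h → SimplifiesTo f h
  step : ∀ {n p} {f : Rule S (suc n)} {h : Rule S p} (i j : Fin (suc n)) →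
         i ≢ j → Coincide f i j → SimplifiesTo (dropArg j f) h → SimplifiesTo f h

Saturated : {S : Set} (_≺_ : S → S → Set) (𝓘 : System S) → MajorClassification _≺_ 𝓘 → Set₁
Saturated _≺_ 𝓘 maj =
  ∀ (g : Idx 𝓘) (nI : ¬ IsIntro _≺_ (rule 𝓘 g)) →
  ∀ (fs : Vec (Idx 𝓘) (proj₁ (maj g nI))) →
  (∀ t → IsIntro _≺_ (rule 𝓘 (lookup fs t))) →
  Σ (Idx 𝓘) λ h →
    SimplifiesTo
      (compose (rule 𝓘 g) (proj₂ (proj₂ (maj g nI))) (map (λ f → arity 𝓘 f , rule 𝓘 f) fs))
      (rule 𝓘 h)

data Sequent (S : Set) : Set where
  ⊢_  : S → Sequent S
  ⊬_  : S → Sequent S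

Complementation : {S : Set} → System S → System S → System (Sequent S)
Complementation {S} 𝓘 𝓙 = record
  { Idx   = Idx 𝓘 ⊎ Idx 𝓙
  ; arity = λ { (inj₁ i) → arity 𝓘 i ; (inj₂ j) → arity 𝓙 j }
  ; rule  = λ { (inj₁ i) xs C → Σ (Vec S (arity 𝓘 i)) λ as → Σ S λ b →
                  (xs ≡ map ⊢_ as) × rule 𝓘 i as b × (C ≡ ⊢ b)
              ; (inj₂ j) xs C → Σ (Vec S (arity 𝓙 j)) λ as → Σ S λ b →
                  (xs ≡ map ⊬_ as) × rule 𝓙 j as b × (C ≡ ⊬ b) } }

-- Since 𝓐 consists of introduction rules for a well-founded order and 𝓑 is
-- its complement, every proposition has a proof in exactly one of 𝓐 and 𝓑.
-- Saturation makes every rule of 𝓘' admissible in 𝓐: a non-introduction rule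
-- whose major premises are proved by introduction rules is replaced by the
-- saturated composite, which strictly decreases the total size of the premise
-- proofs.  Hence if C has a 𝓑-proof, no 𝓘'-derivation, and a fortiori no
-- 𝓘-derivation, of C can have all its premises 𝓐-provable, so each has a
-- 𝓑-provable premise; choosing one premise in each, the complement 𝓙 derives C
-- from 𝓑-provable propositions.  The 𝓑-provable propositions therefore carry
-- a possibly infinite proof of ⊬ A in 𝓘_𝓙.
module Submission where

open import Defs
open import Algebra.Properties.CommutativeSemigroup using (x∙yz≈y∙xz)
open import Data.Empty using (⊥; ⊥-elim)
open import Data.Fin using (Fin; zero; suc)
open import Data.List using (List; []; _∷_)
open import Data.List.Membership.Propositional using (_∈_)
open import Data.List.Relation.Unary.Any using () renaming (here to hereₗ; there to thereₗ)
open import Data.Nat using (ℕ; zero; suc; _+_; _∸_; _≤_; _<_; z≤n; s≤s; pred)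
open import Data.Nat.Induction using (<-wellFounded)
open import Data.Nat.Properties using (m+[n∸m]≡n; +-assoc; +-commutativeSemigroup; +-monoʳ-≤; m≤n+m; m<n+m; +-monoˡ-<; ≤-refl; ≤-trans; module ≤-Reasoning)
open import Data.Product using (Σ; _×_; _,_; proj₁; proj₂)
open import Data.Sum using (_⊎_; inj₁; inj₂; fromInj₂) renaming (map₁ to ⊎-map₁; map₂ to ⊎-map₂)
open import Data.Unit using (tt)
open import Data.Vec using (Vec; []; _∷_; lookup; removeAt; cast; take; drop; _++_; map; tabulate; sum)
open import Data.Vec.Membership.Propositional renaming (_∈_ to _∈ᵥ_)
open import Data.Vec.Membership.Propositional.Properties using (fromAny; toAny)
open import Data.Vec.Properties using (take++drop≡id; ++-injectiveˡ; ++-injectiveʳ; cast-is-id; lookup-map)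
open import Data.Vec.Relation.Unary.All as All using (All; []; _∷_)
open import Data.Vec.Relation.Unary.All.Properties using (lookup⁺; lookup⁻; ++⁺; map⁺)
open import Data.Vec.Relation.Unary.Any as Any using (Any; here; there)
open import Data.Vec.Relation.Unary.Any.Properties using (lookup-index)
open import Function.Bundles using (Equivalence)
open import Induction.WellFounded using (WellFounded; Acc; acc)
open import Relation.Binary.Definitions using (Transitive)
open import Relation.Binary.PropositionalEquality using (_≡_; refl; sym; cong; subst; module ≡-Reasoning)
open import Relation.Nullary using (¬_; yes; no)
open import Relation.Nullary.Decidable using (¬¬-excluded-middle)

private
  variable
    S A : Set
    m n : ℕ

take-++ : (xs : Vec A m) (ys : Vec A n) → take m (xs ++ ys) ≡ xs
take-++ {m = m} xs ys = ++-injectiveˡ (take m (xs ++ ys)) xs (take++drop≡id m (xs ++ ys))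

drop-++ : (xs : Vec A m) (ys : Vec A n) → drop m (xs ++ ys) ≡ ys
drop-++ {m = m} xs ys = ++-injectiveʳ (take m (xs ++ ys)) xs (take++drop≡id m (xs ++ ys))

Any-cast⁻ : {P : A → Set} .(e : m ≡ n) (xs : Vec A m) → Any P (cast e xs) → Any P xs
Any-cast⁻ {n = suc _} e (x ∷ xs) (here p)  = here p
Any-cast⁻ {n = suc _} e (x ∷ xs) (there p) = there (Any-cast⁻ (cong pred e) xs p)

all⊎any : {P Q : A → Set} {xs : Vec A n} → All (λ x → P x ⊎ Q x) xs → All P xs ⊎ Any Q xs
all⊎any []             = inj₁ []
all⊎any (inj₁ p ∷ pqs) = ⊎-map₁ (p ∷_) (⊎-map₂ there (all⊎any pqs))
all⊎any (inj₂ q ∷ _)   = inj₂ (here q)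

choice-meets : {L : List (Seq S)} {s s′ : Seq S} → Choice L s → s′ ∈ L → Any (_∈ᵥ proj₂ s) (proj₂ s′)
choice-meets (y∈xs ∷ _) (hereₗ refl) = toAny y∈xs (here refl)
choice-meets (_ ∷ ch)   (thereₗ s′∈L) = Any.map there (choice-meets ch s′∈L)

choice-or : {G : Set} {Q : S → Set} (L : List (Seq S)) →
            (∀ {s} → s ∈ L → G ⊎ Any Q (proj₂ s)) →
            G ⊎ Σ (Seq S) λ s → Choice L s × All Q (proj₂ s)
choice-or []      _    = inj₂ ((0 , []) , [] , [])
choice-or (_ ∷ L) pick with pick (hereₗ refl) | choice-or L (λ s∈L → pick (thereₗ s∈L))
... | inj₁ g | _      = inj₁ g
... | inj₂ _ | inj₁ g = inj₁ g
... | inj₂ q | inj₂ ((_ , ys) , ch , qs) with fromAny q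
...   | y , y∈s , qy = inj₂ ((_ , y ∷ ys) , y∈s ∷ ch , qy ∷ qs)

OneStep : System S → (S → Set) → S → Set
OneStep {S} 𝓚 Q B = Σ (Idx 𝓚) λ i → Σ (Vec S (arity 𝓚 i)) λ xs → rule 𝓚 i xs B × All Q xs

Derivable-elim : {𝓚 : System S} {B : S} (P : Seq S → Set) →
                 (∀ {i xs} → rule 𝓚 i xs B → P (arity 𝓚 i , xs)) →
                 ∀ {s} → Derivable 𝓚 B s → P s
Derivable-elim _ f (_ , _ , refl , r) = f r

module _ {𝓚 𝓛 : System S} (c : IsComplement 𝓚 𝓛) where

  complement-meets : ∀ {B i j xs ys} → rule 𝓚 i xs B → rule 𝓛 j ys B → Any (_∈ᵥ ys) xs
  complement-meets {B} {i} {j} {xs} {ys} r r′ with proj₂ c B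
  ... | _ , (_ , enum) , choice =
    choice-meets (Equivalence.to (choice _) (j , ys , refl , r′))
                 (Equivalence.from (enum _) (i , xs , refl , r))

  complement-or : {G : Set} {Q : S → Set} (B : S) →
                  (∀ {i xs} → rule 𝓚 i xs B → G ⊎ Any Q xs) → G ⊎ OneStep 𝓛 Q B
  complement-or {G} {Q} B pick with proj₂ c B
  ... | L , (_ , enum) , choice =
    ⊎-map₂ (λ (s , ch , qs) → Derivable-elim {𝓚 = 𝓛} {B} (λ s → All Q (proj₂ s) → OneStep 𝓛 Q B)
                                (λ r qs → _ , _ , r , qs) (Equivalence.from (choice s) ch) qs)
           (choice-or L (λ s∈L → Derivable-elim {𝓚 = 𝓚} {B} (λ s → G ⊎ Any Q (proj₂ s)) pick
                                   (Equivalence.to (enum _) s∈L)))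

  complement-disjoint : ∀ {C} → Proof 𝓚 C → ¬ Proof 𝓛 C
  complement-disjoint (node i xs r ps) (node j ys r′ qs) =
    complement-disjoint (ps (Any.index shared))
                        (All.lookup (lookup⁻ {P = Proof 𝓛} {xs = ys} qs) (lookup-index shared))
    where
    shared : Any (_∈ᵥ ys) xs
    shared = complement-meets r r′

module _ {𝓚 𝓛 : System S} where

  ⊬-proof⇒proof : ∀ {C} → Proof (Complementation 𝓚 𝓛) (⊬ C) → Proof 𝓛 C
  ⊬-proof⇒proof p = go p refl
    where
    go : ∀ {X C} → Proof (Complementation 𝓚 𝓛) X → X ≡ ⊬ C → Proof 𝓛 C
    go (node (inj₁ _) _ (_ , _ , _ , _ , refl) _) ()
    go (node (inj₂ j) _ (as , _ , refl , r , refl) qs) refl =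
      node j as r (λ t → go (qs t) (lookup-map t ⊬_ as))

  ⊬-coinduction : (P : S → Set) → (∀ {C} → P C → OneStep 𝓛 P C) →
                  ∀ {A} → P A → InfProof (Complementation 𝓚 𝓛) (⊬ A)
  ⊬-coinduction P closed PA = Refuted , PA , λ
      { (⊢ _) ()
      ; (⊬ C) PC → let (j , ys , r , ps) = closed PC in
                   inj₂ j , map ⊬_ ys , (ys , C , refl , r , refl) , lookup⁺ (map⁺ {P = Refuted} ps)
      }
    where
    Refuted : Sequent S → Set
    Refuted (⊢ _) = ⊥
    Refuted (⊬ C) = P C

module _ {_≺_ : S → S → Set} (wf : WellFounded _≺_) {𝓐 𝓑 : System S}
         (intro : ∀ i → IsIntro _≺_ (rule 𝓐 i)) (c : IsComplement 𝓐 𝓑) where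

  provable⊎refutable : ∀ C → Proof 𝓐 C ⊎ Proof 𝓑 C
  provable⊎refutable C = go C (wf C)
    where
    go : ∀ C → Acc _≺_ C → Proof 𝓐 C ⊎ Proof 𝓑 C
    go C (acc rec) = ⊎-map₂ (λ (j , ys , r , qs) → node j ys r (lookup⁺ qs)) (complement-or c C premises)
      where
      premises : ∀ {i xs} → rule 𝓐 i xs C → Proof 𝓐 C ⊎ Any (Proof 𝓑) xs
      premises {i} {xs} r = ⊎-map₁ (λ ps → node i xs r (lookup⁺ ps))
                                   (all⊎any {P = Proof 𝓐}
                                            (lookup⁻ {xs = xs} λ t → go _ (rec (intro i xs C r t))))

module _ {𝓚 : System S} where

  size : ∀ {C} → Proof 𝓚 C → ℕ
  size (node _ _ _ ps) = suc (sum (tabulate λ t → size (ps t)))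

  sizes : {xs : Vec S n} → All (Proof 𝓚) xs → ℕ
  sizes []       = 0
  sizes (p ∷ ps) = size p + sizes ps

  sizes-lookup⁻ : {xs : Vec S n} (ps : ∀ t → Proof 𝓚 (lookup xs t)) →
                  sizes (lookup⁻ {xs = xs} ps) ≡ sum (tabulate λ t → size (ps t))
  sizes-lookup⁻ {xs = []}    ps = refl
  sizes-lookup⁻ {xs = _ ∷ xs} ps = cong (size (ps zero) +_) (sizes-lookup⁻ {xs = xs} (λ t → ps (suc t)))

  sizes-++⁺ : {xs : Vec S m} {ys : Vec S n} (ps : All (Proof 𝓚) xs) (qs : All (Proof 𝓚) ys) →
              sizes (++⁺ ps qs) ≡ sizes ps + sizes qs
  sizes-++⁺ []       qs = refl
  sizes-++⁺ (p ∷ ps) qs = begin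
    size p + sizes (++⁺ ps qs)     ≡⟨ cong (size p +_) (sizes-++⁺ ps qs) ⟩
    size p + (sizes ps + sizes qs) ≡⟨ +-assoc (size p) _ _ ⟨
    size p + sizes ps + sizes qs   ∎
    where open ≡-Reasoning

  splitAt-sizes : (m≤n : m ≤ n) {xs : Vec S n} (ps : All (Proof 𝓚) xs) →
          Σ (Vec S m) λ cs → Σ (Vec S (n ∸ m)) λ ds → cast (m+[n∸m]≡n m≤n) (cs ++ ds) ≡ xs ×
          Σ (All (Proof 𝓚) cs) λ pc → Σ (All (Proof 𝓚) ds) λ pd → sizes pc + sizes pd ≡ sizes ps
  splitAt-sizes z≤n {xs} ps = [] , xs , cast-is-id refl xs , [] , ps , refl
  splitAt-sizes (s≤s m≤n) {x ∷ _} (p ∷ ps) with splitAt-sizes m≤n ps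
  ... | cs , ds , e , pc , pd , eq =
    x ∷ cs , ds , cong (x ∷_) e , p ∷ pc , pd , (begin
      size p + sizes pc + sizes pd   ≡⟨ +-assoc (size p) _ _ ⟩
      size p + (sizes pc + sizes pd) ≡⟨ cong (size p +_) eq ⟩
      size p + sizes ps              ∎)
    where open ≡-Reasoning

  removeAt⁺ : {zs : Vec S (suc n)} (j : Fin (suc n)) (ps : All (Proof 𝓚) zs) →
              Σ (All (Proof 𝓚) (removeAt zs j)) λ qs → sizes qs ≤ sizes ps
  removeAt⁺ zero (p ∷ ps) = ps , m≤n+m (sizes ps) (size p)
  removeAt⁺ {zs = _ ∷ _ ∷ _} (suc j) (p ∷ ps) with removeAt⁺ j ps
  ... | qs , le = p ∷ qs , +-monoʳ-≤ (size p) le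

  simplify-premises : ∀ {p C} {f : Rule S n} {h : Rule S p} → SimplifiesTo f h →
                      ∀ {zs} → f zs C → (ps : All (Proof 𝓚) zs) →
                      Σ (Vec S p) λ zs′ → h zs′ C × Σ (All (Proof 𝓚) zs′) λ ps′ → sizes ps′ ≤ sizes ps
  simplify-premises (stop _ f≐h) {zs} r ps = zs , proj₁ (f≐h zs _) r , ps , ≤-refl
  simplify-premises (step _ j _ _ rest) {zs} r ps with removeAt⁺ j ps
  ... | qs , le with simplify-premises rest (zs , refl , r) qs
  ...   | zs′ , r′ , ps′ , le′ = zs′ , r′ , ps′ , ≤-trans le′ le

Apps-∷ : ∀ {a k} {f : Rule S a} {fs : Vec (Σ ℕ (Rule S)) k} {ys us c cs} →
         f ys c → Apps fs us cs → Apps ((a , f) ∷ fs) (ys ++ us) (c ∷ cs)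
Apps-∷ {f = f} {fs} {ys} {us} {c} {cs} r apps =
  subst (λ v → f v c) (sym (take-++ ys us)) r ,
  subst (λ v → Apps fs v cs) (sym (drop-++ ys us)) apps

compose⁺ : ∀ {g : Rule S n} {m≤n : m ≤ n} {fs : Vec (Σ ℕ (Rule S)) m} {us ds cs B} →
           Apps fs us cs → g (cast (m+[n∸m]≡n m≤n) (cs ++ ds)) B → compose g m≤n fs (us ++ ds) B
compose⁺ {g = g} {m≤n} {fs} {us} {ds} {cs} {B} apps r =
  cs , subst (λ v → Apps fs v cs) (sym (take-++ us ds)) apps ,
       subst (λ v → g (cast (m+[n∸m]≡n m≤n) (cs ++ v)) B) (sym (drop-++ us ds)) r

module _ {_≺_ : S → S → Set} {𝓘′ : System S}
         (maj : MajorClassification _≺_ 𝓘′) (sat : Saturated _≺_ 𝓘′ maj) where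

  private
    𝓐 : System S
    𝓐 = IntroRules _≺_ 𝓘′

    F : Idx 𝓘′ → Σ ℕ (Rule S)
    F f = arity 𝓘′ f , rule 𝓘′ f

  peel-intros : {cs : Vec S m} (pc : All (Proof 𝓐) cs) →
         Σ (Vec (Idx 𝓘′) m) λ fs → (∀ t → IsIntro _≺_ (rule 𝓘′ (lookup fs t))) ×
         Σ (Vec S (sumAr (map F fs))) λ us → Apps (map F fs) us cs ×
         Σ (All (Proof 𝓐) us) λ pu → m + sizes pu ≡ sizes pc
  peel-intros [] = [] , (λ ()) , [] , tt , [] , refl
  peel-intros {suc m} (node (i , intro) ys r qs ∷ pc) with peel-intros pc
  ... | fs , intros , us , apps , pu , eq =
    i ∷ fs , (λ { zero → intro ; (suc t) → intros t }) , ys ++ us , Apps-∷ {f = rule 𝓘′ i} r apps ,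
    ++⁺ pys pu , (begin
      suc m + sizes (++⁺ pys pu)          ≡⟨ cong (suc m +_) (sizes-++⁺ pys pu) ⟩
      suc (m + (sizes pys + sizes pu))    ≡⟨ cong suc (x∙yz≈y∙xz +-commutativeSemigroup m (sizes pys) _) ⟩
      suc (sizes pys + (m + sizes pu))    ≡⟨ cong (λ k → suc (sizes pys + k)) eq ⟩
      suc (sizes pys + sizes pc)          ≡⟨ cong (λ k → suc k + sizes pc) (sizes-lookup⁻ {xs = ys} qs) ⟩
      size (node (i , intro) ys r qs) + sizes pc ∎)
    where
    open ≡-Reasoning
    pys : All (Proof 𝓐) ys
    pys = lookup⁻ qs

  saturation-step : ∀ g {xs C} → ¬ IsIntro _≺_ (rule 𝓘′ g) → rule 𝓘′ g xs C →
                    (ps : All (Proof 𝓐) xs) →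
                    Σ (Idx 𝓘′) λ h → Σ (Vec S (arity 𝓘′ h)) λ zs → rule 𝓘′ h zs C ×
                    Σ (All (Proof 𝓐) zs) λ pz → sizes pz < sizes ps
  saturation-step g nI r ps with maj g nI | sat g nI
  ... | m , 0<m , m≤n | sat-g with splitAt-sizes m≤n ps
  ... | cs , ds , refl , pc , pd , eq-split with peel-intros pc
  ... | fs , intros , us , apps , pu , eq-peel with sat-g fs intros
  ... | h , simp with simplify-premises simp (compose⁺ {g = rule 𝓘′ g} {m≤n} {ds = ds} apps r) (++⁺ pu pd)
  ... | zs , r′ , pz , le = h , zs , r′ , pz , (begin-strict
    sizes pz                   ≤⟨ le ⟩
    sizes (++⁺ pu pd)          ≡⟨ sizes-++⁺ pu pd ⟩
    sizes pu + sizes pd        <⟨ +-monoˡ-< (sizes pd) (m<n+m (sizes pu) 0<m) ⟩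
    m + sizes pu + sizes pd    ≡⟨ cong (_+ sizes pd) eq-peel ⟩
    sizes pc + sizes pd        ≡⟨ eq-split ⟩
    sizes ps                   ∎)
    where open ≤-Reasoning

  -- Whether g is an introduction rule is not decidable, hence the double negation.
  admissible : ∀ g {xs C} → rule 𝓘′ g xs C → All (Proof 𝓐) xs → ¬ ¬ Proof 𝓐 C
  admissible g r ps = go g r ps (<-wellFounded (sizes ps))
    where
    go : ∀ g {xs C} → rule 𝓘′ g xs C → (ps : All (Proof 𝓐) xs) → Acc _<_ (sizes ps) → ¬ ¬ Proof 𝓐 C
    go g r ps (acc rec) k = ¬¬-excluded-middle λ where
      (yes intro) → k (node (g , intro) _ r (lookup⁺ ps))
      (no nI)     → let (h , _ , r′ , pz , smaller) = saturation-step g nI r ps in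
                    go h r′ pz (rec smaller) k

module _ {_≺_ : S → S → Set} (wf : WellFounded _≺_) {𝓘′ 𝓑 : System S}
         (maj : MajorClassification _≺_ 𝓘′) (sat : Saturated _≺_ 𝓘′ maj)
         (c : IsComplement (IntroRules _≺_ 𝓘′) 𝓑) where

  refuted-premise : ∀ g {xs C} → rule 𝓘′ g xs C → Proof 𝓑 C → Any (Proof 𝓑) xs
  refuted-premise g {xs} r ref
    with All.decide (provable⊎refutable wf {IntroRules _≺_ 𝓘′} proj₂ c) xs
  ... | inj₂ some = some
  ... | inj₁ all  =
    ⊥-elim (admissible {_≺_ = _≺_} {𝓘′} maj sat g r all (λ p → complement-disjoint c p ref))

  refutation-step : {𝓘 𝓙 : System S} → 𝓘 ⊆ₛ 𝓘′ → IsComplement 𝓘 𝓙 →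
                    ∀ {C} → Proof 𝓑 C → OneStep 𝓙 (Proof 𝓑) C
  refutation-step {𝓘} sub cI {C} ref = fromInj₂ ⊥-elim (complement-or cI C refuted)
    where
    refuted : ∀ {i ys} → rule 𝓘 i ys C → ⊥ ⊎ Any (Proof 𝓑) ys
    refuted {i} {ys} r with sub i
    ... | i′ , e , conv = inj₂ (Any-cast⁻ e ys (refuted-premise i′ (proj₁ (conv ys C) r) ref))

theorem3 : {S : Set} (_≺_ : S → S → Set) → WellFounded _≺_ → Transitive _≺_ →
    (𝓘 𝓙 𝓘' 𝓑 : System S) →
    Functional 𝓘 → Functional 𝓙 → Functional 𝓘' → Functional 𝓑 →
    FiniteInConclusions 𝓘 → IsComplement 𝓘 𝓙 →
    𝓘 ⊆ₛ 𝓘' → Equivalent 𝓘 𝓘' →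
    (maj : MajorClassification _≺_ 𝓘') → Saturated _≺_ 𝓘' maj →
    FiniteInConclusions (IntroRules _≺_ 𝓘') → IsComplement (IntroRules _≺_ 𝓘') 𝓑 →
    ∀ (A : S) → Proof (Complementation (IntroRules _≺_ 𝓘') 𝓑) (⊬ A) →
    InfProof (Complementation 𝓘 𝓙) (⊬ A)
theorem3 _≺_ wf _ 𝓘 𝓙 𝓘' 𝓑 _ _ _ _ _ cI sub _ maj sat _ cA A prf =
  ⊬-coinduction (Proof 𝓑) (refutation-step wf maj sat cA sub cI) (⊬-proof⇒proof prf)
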